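{- Let $1<p\le n$. For each vertex $w$ of the connected component $B(12\cdots p\,\bar p)$ of $G_n$, let $\xi_p(w)=\tilde w$ be the word obtained from $w$ by deleting the letters $z$ and $\bar z$, where $z$ is the smallest unbarred letter such that both $z$ and $\bar z$ occur in $w$ and $N(z)=z+1$ in $w$. Then $\xi_p$ (with $\xi_p(0)=0$) is a crystal isomorphism from $B(12\cdots p\,\bar p)$ onto $B(12\cdots(p-1))$.
   Context: Alphabet $\mathcal{C}_n=\{1<\dots<n<\bar n<\dots<\bar 1\}$, words $\mathcal{C}_n^*$, crystal graph $G_n$ on $\mathcal{C}_n^*$ with arrows $w\xrightarrow{i}\tilde f_i(w)$, where $\tilde e_i,\tilde f_i$ ($1\le i\le n$) are Kashiwara's operators of $U_q(\mathfrak{sp}_{2n})$: on letters $\tilde f_i(i)=i+1$, $\tilde f_i(\overline{i+1})=\bar i$ for $i<n$, $\tilde f_n(n)=\bar n$, $\tilde e_i$ inverse, other values $0$; on words via the signature rule (mark letters with $\tilde f_i\ne0$ by $+$, with $\tilde e_i\ne0$ by $-$, cancel adjacent $+-$ pairs repeatedly, $\tilde f_i$ acts on the leftmost remaining $+$, $\tilde e_i$ on the rightmost remaining $-$, result $0$ if none). $B(w)$ is the connected component of $w$. For a word $w$ and unbarred $m$, $N(m)$ is the number of letters $x$ of $w$ with $x\le m$ or $x\ge\bar m$. A column word is a strictly increasing word; it is admissible if $N(m)\le m$ for all $m=1,\dots,n$. It is shown in the paper that the vertices of $B(12\cdots p\bar p)$ are exactly the non-admissible column words of length $p+1$ all of whose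 proper factors (shorter consecutive subwords) are admissible column words; for such a word the letter $z$ above exists. A crystal isomorphism is a bijection $\xi$ of the vertex sets extended by $\xi(0)=0$ commuting with all $\tilde e_i,\tilde f_i$. -}

module Defs where

open import Data.Nat using (ℕ; zero; suc; _+_; _<_; _∸_)
import Data.Nat as ℕ
open import Data.Fin using (Fin; toℕ; fromℕ<)
import Data.Fin as F
import Data.Fin.Properties as FP
open import Data.List using (List; []; _∷_; _++_; map; filter; length; reverse; allFin)
open import Data.List.Relation.Unary.Any using (any?)
open import Data.Maybe using (Maybe; just; nothing)
import Data.Maybe as Maybe
open import Data.Product using (_×_; _,_; ∃)
open import Relation.Binary.PropositionalEquality using (_≡_; refl; cong)
open import Relation.Nullary using (Dec; yes; no; ¬_)
open import Relation.Nullary.Decidable using (_×-dec_; ⌊_⌋)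
open import Relation.Binary.Definitions using (DecidableEquality)
open import Data.Bool using (Bool; true; false; if_then_else_)

-- Letters of C_n = {1 < ... < n < n̄ < ... < 1̄}.
-- unbar k stands for the letter (toℕ k + 1), bar k for its barred version.
data Letter (n : ℕ) : Set where
  unbar : Fin n → Letter n
  bar   : Fin n → Letter n

Word : ℕ → Set
Word n = List (Letter n)

_≟L_ : ∀ {n} → DecidableEquality (Letter n)
unbar i ≟L unbar j with i F.≟ j
... | yes refl = yes refl
... | no ne = no λ { refl → ne refl }
unbar i ≟L bar j = no λ ()
bar i ≟L unbar j = no λ ()
bar i ≟L bar j with i F.≟ j
... | yes refl = yes refl
... | no ne = no λ { refl → ne refl }

-- Kashiwara operators on letters.  The index i : Fin n stands for the
-- operator label toℕ i + 1 ∈ {1,…,n}.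
-- f_i(i) = i+1, f_i(overline{i+1}) = overline{i} (i<n);  f_n(n) = n̄.
fLetter : ∀ {n} → Fin n → Letter n → Maybe (Letter n)
fLetter {n} i (unbar j) with j F.≟ i
... | no _ = nothing
... | yes _ with suc (toℕ i) ℕ.<? n
...   | yes lt = just (unbar (fromℕ< lt))
...   | no _ = just (bar i)
fLetter {n} i (bar j) with toℕ j ℕ.≟ suc (toℕ i)
... | yes _ = just (bar i)
... | no _ = nothing

eLetter : ∀ {n} → Fin n → Letter n → Maybe (Letter n)
eLetter {n} i (unbar j) with toℕ j ℕ.≟ suc (toℕ i)
... | yes _ = just (unbar i)
... | no _ = nothing
eLetter {n} i (bar j) with j F.≟ i
... | no _ = nothing
... | yes _ with suc (toℕ i) ℕ.<? n
...   | yes lt = just (bar (fromℕ< lt))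
...   | no _ = just (unbar i)

data Sign : Set where
  plus minus : Sign

sign : ∀ {n} → Fin n → Letter n → Maybe Sign
sign i x with fLetter i x | eLetter i x
... | just _  | _      = just plus
... | nothing | just _ = just minus
... | nothing | nothing = nothing

-- Scan left to right, keeping the (reversed) list of not-yet-cancelled
-- marked positions; a − cancels the closest uncancelled + on its left
-- (this is exactly repeated cancellation of adjacent +− pairs).
reduceSig : ∀ {n} → Fin n → ℕ → Word n → List (ℕ × Sign) → List (ℕ × Sign)
reduceSig i k [] st = st
reduceSig i k (x ∷ w) st with sign i x
... | nothing = reduceSig i (suc k) w st
... | just plus = reduceSig i (suc k) w ((k , plus) ∷ st)
... | just minus with st
...   | (j , plus) ∷ st' = reduceSig i (suc k) w st'
...   | _ = reduceSig i (suc k) w ((k , minus) ∷ st)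

reducedSig : ∀ {n} → Fin n → Word n → List (ℕ × Sign)
reducedSig i w = reverse (reduceSig i 0 w [])

firstWith : Sign → List (ℕ × Sign) → Maybe ℕ
firstWith s [] = nothing
firstWith plus ((k , plus) ∷ l) = just k
firstWith minus ((k , minus) ∷ l) = just k
firstWith plus ((k , minus) ∷ l) = firstWith plus l
firstWith minus ((k , plus) ∷ l) = firstWith minus l

applyAt : ∀ {n} → ℕ → (Letter n → Maybe (Letter n)) → Word n → Maybe (Word n)
applyAt k g [] = nothing
applyAt zero g (x ∷ w) = Maybe.map (_∷ w) (g x)
applyAt (suc k) g (x ∷ w) = Maybe.map (x ∷_) (applyAt k g w)

-- f_i acts on the leftmost remaining +, e_i on the rightmost remaining −;
-- nothing plays the role of 0.
fOp : ∀ {n} → Fin n → Word n → Maybe (Word n)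
fOp i w with firstWith plus (reducedSig i w)
... | nothing = nothing
... | just k = applyAt k (fLetter i) w

eOp : ∀ {n} → Fin n → Word n → Maybe (Word n)
eOp i w with firstWith minus (reverse (reducedSig i w))
... | nothing = nothing
... | just k = applyAt k (eLetter i) w

-- Reach u w : w is a vertex of the connected component B(u) of G_n.
data Reach {n : ℕ} (u : Word n) : Word n → Set where
  here : Reach u u
  viaF : ∀ {v v'} (i : Fin n) → Reach u v → fOp i v ≡ just v' → Reach u v'
  viaE : ∀ {v v'} (i : Fin n) → Reach u v → eOp i v ≡ just v' → Reach u v'

colUpTo : (n p : ℕ) → Word n
colUpTo n p = map unbar (filter (λ k → suc (toℕ k) ℕ.≤? p) (allFin n))

-- the word p̄ (for 1 ≤ p ≤ n it has exactly one letter)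
barWord : (n p : ℕ) → Word n
barWord n p = map bar (filter (λ k → suc (toℕ k) ℕ.≟ p) (allFin n))

-- N(m) for the unbarred letter m = toℕ k + 1: letters x ≤ m or x ≥ m̄
inN : ∀ {n} → Fin n → Letter n → Bool
inN k (unbar j) = ⌊ j F.≤? k ⌋
inN k (bar j) = ⌊ j F.≤? k ⌋

Ncount : ∀ {n} → Fin n → Word n → ℕ
Ncount k w = length (filter (λ x → inN k x Data.Bool.≟ true) w)

-- the condition on z = toℕ k + 1: z and z̄ occur in w and N(z) = z + 1
zCond : ∀ {n} → Word n → Fin n → Set
zCond w k = (Data.List.Relation.Unary.Any.Any (unbar k ≡_) w
            × Data.List.Relation.Unary.Any.Any (bar k ≡_) w)
            × Ncount k w ≡ suc (suc (toℕ k))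

zCond? : ∀ {n} (w : Word n) (k : Fin n) → Dec (zCond w k)
zCond? w k = (any? (unbar k ≟L_) w ×-dec any? (bar k ≟L_) w)
             ×-dec (Ncount k w ℕ.≟ suc (suc (toℕ k)))

-- the smallest such z (allFin lists Fin n in increasing order)
findZ : ∀ {n} → Word n → Maybe (Fin n)
findZ {n} w = Data.List.head (filter (zCond? w) (allFin n))

-- ξ_p(w): delete the letters z and z̄ (identity if no such z exists,
-- which does not happen on B(1 2 ⋯ p p̄))
xi : ∀ {n} → Word n → Word n
xi w with findZ w
... | nothing = w
... | just k = filter (λ x → ¬? ((x ≟L unbar k) ⊎-dec (x ≟L bar k))) w
  where open import Relation.Nullary.Decidable using (¬?; _⊎-dec_)

record IsCrystalIso {n : ℕ} (u v : Word n) (ξ : Word n → Word n) : Set where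
  field
    into       : ∀ w → Reach u w → Reach v (ξ w)
    injective  : ∀ w w' → Reach u w → Reach u w' → ξ w ≡ ξ w' → w ≡ w'
    surjective : ∀ y → Reach v y → ∃ λ w → Reach u w × ξ w ≡ y
    commute-f  : ∀ w → Reach u w → ∀ (i : Fin n) → Maybe.map ξ (fOp i w) ≡ fOp i (ξ w)
    commute-e  : ∀ w → Reach u w → ∀ (i : Fin n) → Maybe.map ξ (eOp i w) ≡ eOp i (ξ w)

module Submission where

-- A column word is recorded by the pairs (k ∈ w, k̄ ∈ w), k = 1, …, n.  Reading them upwards, the
-- slack m − N(m) rises at an empty pair and drops at a full one, and admissibility says that it never
-- becomes negative.  The inverse of ξ_p fills the first empty pair z that is reached at slack 0 and
-- after which the column stays admissible: on the result N(m) ≤ m below z and N(z) = z + 1, so ξ_p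
-- deletes exactly z and z̄ again, and 1 ⋯ (p−1) is sent to 1 ⋯ p p̄.  By the signature rule, letters
-- carrying no sign for f̃ᵢ, ẽᵢ can be ignored, so on columns these operators only change the pairs at i
-- and i + 1; a finite case check shows that they commute with the insertion and do not change
-- admissibility.  Hence the insertion maps B(1 ⋯ (p−1)) onto B(1 ⋯ p p̄) compatibly with the
-- operators, and ξ_p is its inverse.

open import Defs
open import Data.Bool using (Bool; true; false; if_then_else_; T; not)
open import Data.Empty using (⊥-elim)
open import Data.Fin using (Fin; toℕ)
import Data.Fin as F
open import Data.List using (List; []; _∷_; _++_; map; length; reverse; take; drop; filter; head; allFin)
import Data.List as List
open import Data.List.Membership.Propositional using (_∈_)
open import Data.List.Membership.Propositional.Properties using (∈-map⁺; ∈-map⁻; ∈-++⁺ˡ; ∈-++⁺ʳ; ∈-++⁻)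
open import Data.List.Properties
  using (take-all; drop-all; ++-identityʳ; ++-assoc; map-++; reverse-map; map-id-local; filter-++; filter-none;
         length-++; length-map; map-tabulate; head-map)
import Data.List.Properties as List
open import Data.List.Relation.Unary.All using (All; []; _∷_)
import Data.List.Relation.Unary.All as AllL
import Data.List.Relation.Unary.All.Properties as AllP
open import Data.List.Relation.Unary.Any using (here)
open import Data.Maybe using (Maybe; just; nothing; _>>=_)
import Data.Maybe as Maybe
open import Data.Maybe.Properties using (map-id; map-∘; map-cong; map-cong-local; just-injective)
import Data.Maybe.Relation.Unary.All as MaybeAll
import Data.Maybe.Relation.Unary.All.Properties as MaybeAllP
open import Data.Nat using (ℕ; zero; suc; _+_; _<_; _≤_; _∸_; _<ᵇ_; z≤n; s≤s)
import Data.Nat as ℕ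
open import Data.Nat.Properties
  using (+-suc; +-identityʳ; +-comm; +-assoc; ≤-refl; ≤-trans; ≤-reflexive; n≤1+n; m≤n+m; m<n⇒m<1+n; ≤⇒≯;
         1+n≰n; +-monoʳ-≤; <ᵇ⇒<; <⇒<ᵇ)
open import Data.Product using (_×_; _,_; proj₁; proj₂; map₁; ∃)
open import Data.Sum using (inj₁; inj₂)
open import Data.Vec using (Vec; []; _∷_; lookup; tabulate; _[_]≔_)
open import Data.Vec.Properties using (tabulate∘lookup; tabulate-cong)
open import Function using (id)
open import Level using (0ℓ)
open import Relation.Binary.PropositionalEquality
open import Relation.Nullary using (yes; no; does; ¬_)
open import Relation.Nullary.Decidable using (⌊_⌋; ¬?; _⊎-dec_)
open import Relation.Unary using (Pred; Decidable)

-- The signature rule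

shift : ∀ {n} → Letter n → Letter (suc n)
shift (unbar k) = unbar (F.suc k)
shift (bar k) = bar (F.suc k)

data Dir : Set where
  down up : Dir

letterOp : ∀ {n} → Dir → Fin n → Letter n → Maybe (Letter n)
letterOp down = fLetter
letterOp up = eLetter

letterOp-shift : ∀ {n} d (i : Fin n) x → letterOp d (F.suc i) (shift x) ≡ Maybe.map shift (letterOp d i x)
letterOp-shift {n} down i (unbar j) with j F.≟ i
... | no _ = refl
... | yes refl with suc (toℕ i) ℕ.<? n | suc (suc (toℕ i)) ℕ.<? suc n
...   | yes _ | yes _ = refl
...   | no _ | no _ = refl
...   | yes p | no q = ⊥-elim (q (s≤s p))
...   | no p | yes q = ⊥-elim (p (ℕ.s≤s⁻¹ q))
letterOp-shift down i (bar j) with toℕ j ℕ.≟ suc (toℕ i) | suc (toℕ j) ℕ.≟ suc (suc (toℕ i))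
... | yes _ | yes _ = refl
... | no _ | no _ = refl
... | yes p | no q = ⊥-elim (q (cong suc p))
... | no p | yes q = ⊥-elim (p (cong ℕ.pred q))
letterOp-shift up i (unbar j) with toℕ j ℕ.≟ suc (toℕ i) | suc (toℕ j) ℕ.≟ suc (suc (toℕ i))
... | yes _ | yes _ = refl
... | no _ | no _ = refl
... | yes p | no q = ⊥-elim (q (cong suc p))
... | no p | yes q = ⊥-elim (p (cong ℕ.pred q))
letterOp-shift {n} up i (bar j) with j F.≟ i
... | no _ = refl
... | yes refl with suc (toℕ i) ℕ.<? n | suc (suc (toℕ i)) ℕ.<? suc n
...   | yes _ | yes _ = refl
...   | no _ | no _ = refl
...   | yes p | no q = ⊥-elim (q (s≤s p))
...   | no p | yes q = ⊥-elim (p (ℕ.s≤s⁻¹ q))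

sign-shift : ∀ {n} (i : Fin n) x → sign (F.suc i) (shift x) ≡ sign i x
sign-shift i x rewrite letterOp-shift down i x | letterOp-shift up i x
  with fLetter i x | eLetter i x
... | just _ | _ = refl
... | nothing | just _ = refl
... | nothing | nothing = refl

Unsigned : ∀ {n} → Fin n → Word n → Set
Unsigned i = All (λ x → sign i x ≡ nothing)

Below : ℕ → List (ℕ × Sign) → Set
Below k = All (λ e → proj₁ e < k)

reduceSig-++ : ∀ {n} (i : Fin n) k (w w′ : Word n) st →
  reduceSig i k (w ++ w′) st ≡ reduceSig i (k + length w) w′ (reduceSig i k w st)
reduceSig-++ i k [] w′ st rewrite +-identityʳ k = refl
reduceSig-++ i k (x ∷ w) w′ st rewrite +-suc k (length w) with sign i x
... | nothing = reduceSig-++ i (suc k) w w′ st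
... | just plus = reduceSig-++ i (suc k) w w′ ((k , plus) ∷ st)
reduceSig-++ i k (x ∷ w) w′ [] | just minus = reduceSig-++ i (suc k) w w′ ((k , minus) ∷ [])
reduceSig-++ i k (x ∷ w) w′ ((j , plus) ∷ st) | just minus = reduceSig-++ i (suc k) w w′ st
reduceSig-++ i k (x ∷ w) w′ ((j , minus) ∷ st) | just minus =
  reduceSig-++ i (suc k) w w′ ((k , minus) ∷ (j , minus) ∷ st)

reduceSig-unsigned : ∀ {n} (i : Fin n) k (w : Word n) st → Unsigned i w → reduceSig i k w st ≡ st
reduceSig-unsigned i k [] st [] = refl
reduceSig-unsigned i k (x ∷ w) st (u ∷ us) rewrite u = reduceSig-unsigned i (suc k) w st us

below-suc : ∀ {k st} → Below k st → Below (suc k) st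
below-suc = AllL.map m<n⇒m<1+n

reduceSig-below : ∀ {n} (i : Fin n) k (w : Word n) st → Below k st → Below (k + length w) (reduceSig i k w st)
reduceSig-below i k [] st b rewrite +-identityʳ k = b
reduceSig-below i k (x ∷ w) st b rewrite +-suc k (length w) with sign i x
... | nothing = reduceSig-below i (suc k) w st (below-suc b)
... | just plus = reduceSig-below i (suc k) w ((k , plus) ∷ st) (≤-refl ∷ below-suc b)
reduceSig-below i k (x ∷ w) [] b | just minus = reduceSig-below i (suc k) w ((k , minus) ∷ []) (≤-refl ∷ [])
reduceSig-below i k (x ∷ w) ((j , plus) ∷ st) (_ ∷ b) | just minus = reduceSig-below i (suc k) w st (below-suc b)
reduceSig-below i k (x ∷ w) ((j , minus) ∷ st) b | just minus =
  reduceSig-below i (suc k) w ((k , minus) ∷ (j , minus) ∷ st) (≤-refl ∷ below-suc b)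

insertPos : ℕ → ℕ → ℕ → ℕ
insertPos b d j = if j <ᵇ b then j else j + d

insertPos-≥ : ∀ {b k} d → b ≤ k → insertPos b d k ≡ k + d
insertPos-≥ {b} {k} d b≤k with k <ᵇ b in eq
... | false = refl
... | true = ⊥-elim (≤⇒≯ b≤k (<ᵇ⇒< k b (subst T (sym eq) _)))

insertPos-< : ∀ {b j} d → j < b → insertPos b d j ≡ j
insertPos-< {b} {j} d j<b with j <ᵇ b in eq
... | true = refl
... | false = ⊥-elim (subst T eq (<⇒<ᵇ j<b))

insertPos-suc : ∀ b d j → insertPos (suc b) d (suc j) ≡ suc (insertPos b d j)
insertPos-suc b d j with j <ᵇ b
... | true = refl
... | false = refl

shiftEntry : ℕ → ℕ → ℕ × Sign → ℕ × Sign
shiftEntry b d = map₁ (insertPos b d)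

shiftEntry-≥ : ∀ {b k} d s → b ≤ k → shiftEntry b d (k , s) ≡ (k + d , s)
shiftEntry-≥ d s b≤k = cong (_, s) (insertPos-≥ d b≤k)

reduceSig-shiftEntry : ∀ {n} (i : Fin n) b d k (w : Word n) st → b ≤ k →
  reduceSig i (k + d) w (map (shiftEntry b d) st) ≡ map (shiftEntry b d) (reduceSig i k w st)
reduceSig-shiftEntry i b d k [] st b≤k = refl
reduceSig-shiftEntry i b d k (x ∷ w) st b≤k with sign i x
... | nothing = reduceSig-shiftEntry i b d (suc k) w st (≤-trans b≤k (n≤1+n k))
... | just plus rewrite sym (shiftEntry-≥ d plus b≤k) =
  reduceSig-shiftEntry i b d (suc k) w ((k , plus) ∷ st) (≤-trans b≤k (n≤1+n k))
reduceSig-shiftEntry i b d k (x ∷ w) [] b≤k | just minus rewrite sym (shiftEntry-≥ d minus b≤k) =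
  reduceSig-shiftEntry i b d (suc k) w ((k , minus) ∷ []) (≤-trans b≤k (n≤1+n k))
reduceSig-shiftEntry i b d k (x ∷ w) ((j , plus) ∷ st) b≤k | just minus =
  reduceSig-shiftEntry i b d (suc k) w st (≤-trans b≤k (n≤1+n k))
reduceSig-shiftEntry i b d k (x ∷ w) ((j , minus) ∷ st) b≤k | just minus rewrite sym (shiftEntry-≥ d minus b≤k) =
  reduceSig-shiftEntry i b d (suc k) w ((k , minus) ∷ (j , minus) ∷ st) (≤-trans b≤k (n≤1+n k))

reducedSig-insert : ∀ {n} (i : Fin n) (P M S : Word n) → Unsigned i M →
  reducedSig i (P ++ M ++ S) ≡ map (shiftEntry (length P) (length M)) (reducedSig i (P ++ S))
reducedSig-insert i P M S uM = begin
    reverse (reduceSig i 0 (P ++ M ++ S) [])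
  ≡⟨ cong reverse (reduceSig-++ i 0 P (M ++ S) []) ⟩
    reverse (reduceSig i |P| (M ++ S) st)
  ≡⟨ cong reverse (reduceSig-++ i |P| M S st) ⟩
    reverse (reduceSig i (|P| + |M|) S (reduceSig i |P| M st))
  ≡⟨ cong (λ s → reverse (reduceSig i (|P| + |M|) S s)) (reduceSig-unsigned i |P| M st uM) ⟩
    reverse (reduceSig i (|P| + |M|) S st)
  ≡⟨ cong (λ s → reverse (reduceSig i (|P| + |M|) S s)) (sym stFixed) ⟩
    reverse (reduceSig i (|P| + |M|) S (map shiftPos st))
  ≡⟨ cong reverse (reduceSig-shiftEntry i |P| |M| |P| S st ≤-refl) ⟩
    reverse (map shiftPos (reduceSig i |P| S st))
  ≡⟨ sym (reverse-map shiftPos (reduceSig i |P| S st)) ⟩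
    map shiftPos (reverse (reduceSig i |P| S st))
  ≡⟨ cong (λ s → map shiftPos (reverse s)) (sym (reduceSig-++ i 0 P S [])) ⟩
    map shiftPos (reducedSig i (P ++ S))
  ∎
  where
  open ≡-Reasoning
  |P| = length P
  |M| = length M
  st = reduceSig i 0 P []
  shiftPos = shiftEntry |P| |M|
  stFixed : map shiftPos st ≡ st
  stFixed = map-id-local (AllL.map (λ {e} lt → cong (_, proj₂ e) (insertPos-< |M| lt)) (reduceSig-below i 0 P [] []))

locate : Dir → List (ℕ × Sign) → Maybe ℕ
locate down s = firstWith plus s
locate up s = firstWith minus (reverse s)

op : ∀ {n} → Dir → Fin n → Word n → Maybe (Word n)
op d i w = locate d (reducedSig i w) >>= λ k → applyAt k (letterOp d i) w

fOp≡op : ∀ {n} (i : Fin n) w → fOp i w ≡ op down i w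
fOp≡op i w with firstWith plus (reducedSig i w)
... | nothing = refl
... | just _ = refl

eOp≡op : ∀ {n} (i : Fin n) w → eOp i w ≡ op up i w
eOp≡op i w with firstWith minus (reverse (reducedSig i w))
... | nothing = refl
... | just _ = refl

firstWith-map₁ : ∀ (g : ℕ → ℕ) s l → firstWith s (map (map₁ g) l) ≡ Maybe.map g (firstWith s l)
firstWith-map₁ g s [] = refl
firstWith-map₁ g plus ((k , plus) ∷ l) = refl
firstWith-map₁ g minus ((k , minus) ∷ l) = refl
firstWith-map₁ g plus ((k , minus) ∷ l) = firstWith-map₁ g plus l
firstWith-map₁ g minus ((k , plus) ∷ l) = firstWith-map₁ g minus l

locate-map₁ : ∀ d (g : ℕ → ℕ) l → locate d (map (map₁ g) l) ≡ Maybe.map g (locate d l)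
locate-map₁ down g l = firstWith-map₁ g plus l
locate-map₁ up g l = trans (cong (firstWith minus) (sym (reverse-map (map₁ g) l))) (firstWith-map₁ g minus (reverse l))

insertAt : ∀ {A : Set} → ℕ → List A → List A → List A
insertAt b M w = take b w ++ M ++ drop b w

insertAt-++ : ∀ {A : Set} (P M S : List A) → insertAt (length P) M (P ++ S) ≡ P ++ M ++ S
insertAt-++ [] M S = refl
insertAt-++ (x ∷ P) M S = cong (x ∷_) (insertAt-++ P M S)

insertAt-end : ∀ {A : Set} (M w w′ : List A) → length w′ ≡ length w → insertAt (length w) M w′ ≡ w′ ++ M
insertAt-end M w w′ eq rewrite sym eq | take-all (length w′) w′ ≤-refl | drop-all (length w′) w′ ≤-refl =
  cong (w′ ++_) (++-identityʳ M)

map-commute : ∀ {A B C D : Set} {f : B → D} {g : A → B} {h : C → D} {k : A → C} →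
  (∀ x → f (g x) ≡ h (k x)) → ∀ r → Maybe.map f (Maybe.map g r) ≡ Maybe.map h (Maybe.map k r)
map-commute same r = trans (sym (map-∘ r)) (trans (map-cong same r) (map-∘ r))

applyAt-++ : ∀ {n} j (g : Letter n → Maybe (Letter n)) (P w : Word n) →
  applyAt (length P + j) g (P ++ w) ≡ Maybe.map (P ++_) (applyAt j g w)
applyAt-++ j g [] w = sym (map-id (applyAt j g w))
applyAt-++ j g (x ∷ P) w rewrite applyAt-++ j g P w = sym (map-∘ (applyAt j g w))

applyAt-insert : ∀ {n} j (g : Letter n → Maybe (Letter n)) (P M S : Word n) →
  applyAt (insertPos (length P) (length M) j) g (P ++ M ++ S) ≡ Maybe.map (insertAt (length P) M) (applyAt j g (P ++ S))
applyAt-insert j g [] M S rewrite +-comm j (length M) = applyAt-++ j g M S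
applyAt-insert zero g (x ∷ P) M S =
  trans (map-cong (λ y → cong (y ∷_) (sym (insertAt-++ P M S))) (g x)) (map-∘ (g x))
applyAt-insert (suc j) g (x ∷ P) M S rewrite insertPos-suc (length P) (length M) j | applyAt-insert j g P M S =
  map-commute (λ _ → refl) (applyAt j g (P ++ S))

op-insert : ∀ {n} d (i : Fin n) (P M S : Word n) → Unsigned i M →
  op d i (P ++ M ++ S) ≡ Maybe.map (insertAt (length P) M) (op d i (P ++ S))
op-insert d i P M S uM
  rewrite reducedSig-insert i P M S uM | locate-map₁ d (insertPos (length P) (length M)) (reducedSig i (P ++ S))
  with locate d (reducedSig i (P ++ S))
... | nothing = refl
... | just j = applyAt-insert j (letterOp d i) P M S

applyAt-length : ∀ {n} k (g : Letter n → Maybe (Letter n)) w → MaybeAll.All (λ w′ → length w′ ≡ length w) (applyAt k g w)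
applyAt-length k g [] = MaybeAll.nothing
applyAt-length zero g (x ∷ w) with g x
... | just _ = MaybeAll.just refl
... | nothing = MaybeAll.nothing
applyAt-length (suc k) g (x ∷ w) with applyAt k g w | applyAt-length k g w
... | just _ | MaybeAll.just eq = MaybeAll.just (cong suc eq)
... | nothing | _ = MaybeAll.nothing

op-length : ∀ {n} d (i : Fin n) w → MaybeAll.All (λ w′ → length w′ ≡ length w) (op d i w)
op-length d i w with locate d (reducedSig i w)
... | just k = applyAt-length k (letterOp d i) w
... | nothing = MaybeAll.nothing

op-prefix : ∀ {n} d (i : Fin n) (P W : Word n) → Unsigned i P → op d i (P ++ W) ≡ Maybe.map (P ++_) (op d i W)
op-prefix d i P W uP = op-insert d i [] P W uP

op-suffix : ∀ {n} d (i : Fin n) (W S : Word n) → Unsigned i S → op d i (W ++ S) ≡ Maybe.map (_++ S) (op d i W)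
op-suffix d i W S uS = begin
    op d i (W ++ S)
  ≡⟨ cong (λ v → op d i (W ++ v)) (sym (++-identityʳ S)) ⟩
    op d i (W ++ S ++ [])
  ≡⟨ op-insert d i W S [] uS ⟩
    Maybe.map (insertAt (length W) S) (op d i (W ++ []))
  ≡⟨ cong (λ v → Maybe.map (insertAt (length W) S) (op d i v)) (++-identityʳ W) ⟩
    Maybe.map (insertAt (length W) S) (op d i W)
  ≡⟨ map-cong-local (MaybeAll.map (insertAt-end S W _) (op-length d i W)) ⟩
    Maybe.map (_++ S) (op d i W)
  ∎
  where open ≡-Reasoning

reduceSig-shift : ∀ {n} (i : Fin n) k (w : Word n) st → reduceSig (F.suc i) k (map shift w) st ≡ reduceSig i k w st
reduceSig-shift i k [] st = refl
reduceSig-shift i k (x ∷ w) st rewrite sign-shift i x with sign i x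
... | nothing = reduceSig-shift i (suc k) w st
... | just plus = reduceSig-shift i (suc k) w ((k , plus) ∷ st)
reduceSig-shift i k (x ∷ w) [] | just minus = reduceSig-shift i (suc k) w ((k , minus) ∷ [])
reduceSig-shift i k (x ∷ w) ((j , plus) ∷ st) | just minus = reduceSig-shift i (suc k) w st
reduceSig-shift i k (x ∷ w) ((j , minus) ∷ st) | just minus = reduceSig-shift i (suc k) w ((k , minus) ∷ (j , minus) ∷ st)

applyAt-map : ∀ {m n} k (f : Letter m → Letter n) g g′ → (∀ x → g (f x) ≡ Maybe.map f (g′ x)) → ∀ w →
  applyAt k g (map f w) ≡ Maybe.map (map f) (applyAt k g′ w)
applyAt-map k f g g′ comm [] = refl
applyAt-map zero f g g′ comm (x ∷ w) rewrite comm x = map-commute (λ _ → refl) (g′ x)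
applyAt-map (suc k) f g g′ comm (x ∷ w) rewrite applyAt-map k f g g′ comm w =
  map-commute (λ _ → refl) (applyAt k g′ w)

op-shift : ∀ {n} d (i : Fin n) w → op d (F.suc i) (map shift w) ≡ Maybe.map (map shift) (op d i w)
op-shift d i w rewrite reduceSig-shift i 0 w [] with locate d (reducedSig i w)
... | nothing = refl
... | just k = applyAt-map k shift (letterOp d (F.suc i)) (letterOp d i) (letterOp-shift d i) w

-- Columns as vectors of pairs

-- the pair at position k records whether the letters k + 1 and its bar occur
Col : ℕ → Set
Col n = Vec (Bool × Bool) n

optional : ∀ {A : Set} → Bool → A → List A
optional true x = x ∷ []
optional false x = []

word : ∀ {n} → Col n → Word n
word [] = []
word ((u , b) ∷ v) = optional u (unbar F.zero) ++ map shift (word v) ++ optional b (bar F.zero)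

-- f̃₁ and ẽ₁ on the pairs of the letters 1 and 2
pairOp : Dir → Bool × Bool → Bool × Bool → Maybe ((Bool × Bool) × (Bool × Bool))
pairOp down (true , true) (false , true) = just ((false , true) , (true , true))
pairOp down (true , false) (true , true) = just ((true , true) , (true , false))
pairOp down (true , false) (false , true) = just ((false , false) , (true , true))
pairOp down (true , false) (false , false) = just ((false , false) , (true , false))
pairOp down (false , false) (true , true) = just ((false , true) , (true , false))
pairOp down (false , false) (false , true) = just ((false , true) , (false , false))
pairOp up (true , true) (true , false) = just ((true , false) , (true , true))
pairOp up (false , true) (true , true) = just ((true , true) , (false , true))
pairOp up (false , true) (true , false) = just ((false , false) , (true , true))
pairOp up (false , true) (false , false) = just ((false , false) , (false , true))
pairOp up (false , false) (true , true) = just ((true , false) , (false , true))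
pairOp up (false , false) (true , false) = just ((true , false) , (false , false))
pairOp _ _ _ = nothing

lastOp : Dir → Bool × Bool → Maybe (Bool × Bool)
lastOp down (true , false) = just (false , true)
lastOp up (false , true) = just (true , false)
lastOp _ _ = nothing

prepend₂ : ∀ {n} → Col n → (Bool × Bool) × (Bool × Bool) → Col (suc (suc n))
prepend₂ v (e₀ , e₁) = e₀ ∷ e₁ ∷ v

colOp : ∀ {n} → Dir → Fin n → Col n → Maybe (Col n)
colOp {suc zero} d F.zero (e ∷ []) = Maybe.map (_∷ []) (lastOp d e)
colOp {suc (suc n)} d F.zero (e₀ ∷ e₁ ∷ v) = Maybe.map (prepend₂ v) (pairOp d e₀ e₁)
colOp d (F.suc i) (e ∷ v) = Maybe.map (e ∷_) (colOp d i v)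

windowL windowR : ∀ {n} → Bool × Bool → Bool × Bool → Word (suc (suc n))
windowL (u₀ , _) (u₁ , _) = optional u₀ (unbar F.zero) ++ map shift (optional u₁ (unbar F.zero))
windowR (_ , b₀) (_ , b₁) = map shift (optional b₁ (bar F.zero)) ++ optional b₀ (bar F.zero)

word-window : ∀ {n} e₀ e₁ (v : Col n) → word (e₀ ∷ e₁ ∷ v) ≡ windowL e₀ e₁ ++ map shift (map shift (word v)) ++ windowR e₀ e₁
word-window (u₀ , b₀) (u₁ , b₁) v = begin
    X ++ map shift (P ++ M ++ C) ++ D
  ≡⟨ cong (λ z → X ++ z ++ D) (trans (map-++ shift P (M ++ C)) (cong (map shift P ++_) (map-++ shift M C))) ⟩
    X ++ (map shift P ++ map shift M ++ map shift C) ++ D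
  ≡⟨ cong (X ++_) (trans (++-assoc (map shift P) _ D) (cong (map shift P ++_) (++-assoc (map shift M) (map shift C) D))) ⟩
    X ++ map shift P ++ map shift M ++ (map shift C ++ D)
  ≡⟨ sym (++-assoc X (map shift P) _) ⟩
    (X ++ map shift P) ++ map shift M ++ (map shift C ++ D)
  ∎
  where
  open ≡-Reasoning
  X = optional u₀ (unbar F.zero)
  P = optional u₁ (unbar F.zero)
  M = map shift (word v)
  C = optional b₁ (bar F.zero)
  D = optional b₀ (bar F.zero)

optional-unsigned : ∀ {n} (i : Fin n) b x → sign i x ≡ nothing → Unsigned i (optional b x)
optional-unsigned i true x s = s ∷ []
optional-unsigned i false x s = []

shift²-unsigned : ∀ {n} (w : Word n) → Unsigned {suc (suc n)} F.zero (map shift (map shift w))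
shift²-unsigned w = AllP.map⁺ (AllP.map⁺ (AllL.universal unsigned w))
  where
  unsigned : ∀ x → sign F.zero (shift (shift x)) ≡ nothing
  unsigned (unbar _) = refl
  unsigned (bar _) = refl

pairOp-window : ∀ {n} d e₀ e₁ (M : Word (suc (suc n))) →
  Maybe.map (insertAt (length (windowL {n} e₀ e₁)) M) (op d F.zero (windowL e₀ e₁ ++ windowR e₀ e₁))
  ≡ Maybe.map (λ p → windowL (proj₁ p) (proj₂ p) ++ M ++ windowR (proj₁ p) (proj₂ p)) (pairOp d e₀ e₁)
pairOp-window down (true , true) (true , true) M = refl
pairOp-window down (true , true) (true , false) M = refl
pairOp-window down (true , true) (false , true) M = refl
pairOp-window down (true , true) (false , false) M = refl
pairOp-window down (true , false) (true , true) M = refl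
pairOp-window down (true , false) (true , false) M = refl
pairOp-window down (true , false) (false , true) M = refl
pairOp-window down (true , false) (false , false) M = refl
pairOp-window down (false , true) (true , true) M = refl
pairOp-window down (false , true) (true , false) M = refl
pairOp-window down (false , true) (false , true) M = refl
pairOp-window down (false , true) (false , false) M = refl
pairOp-window down (false , false) (true , true) M = refl
pairOp-window down (false , false) (true , false) M = refl
pairOp-window down (false , false) (false , true) M = refl
pairOp-window down (false , false) (false , false) M = refl
pairOp-window up (true , true) (true , true) M = refl
pairOp-window up (true , true) (true , false) M = refl
pairOp-window up (true , true) (false , true) M = refl
pairOp-window up (true , true) (false , false) M = refl
pairOp-window up (true , false) (true , true) M = refl
pairOp-window up (true , false) (true , false) M = refl
pairOp-window up (true , false) (false , true) M = refl
pairOp-window up (true , false) (false , false) M = refl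
pairOp-window up (false , true) (true , true) M = refl
pairOp-window up (false , true) (true , false) M = refl
pairOp-window up (false , true) (false , true) M = refl
pairOp-window up (false , true) (false , false) M = refl
pairOp-window up (false , false) (true , true) M = refl
pairOp-window up (false , false) (true , false) M = refl
pairOp-window up (false , false) (false , true) M = refl
pairOp-window up (false , false) (false , false) M = refl

op-word : ∀ {n} d (i : Fin n) (v : Col n) → op d i (word v) ≡ Maybe.map word (colOp d i v)
op-word down F.zero ((true , true) ∷ []) = refl
op-word down F.zero ((true , false) ∷ []) = refl
op-word down F.zero ((false , true) ∷ []) = refl
op-word down F.zero ((false , false) ∷ []) = refl
op-word up F.zero ((true , true) ∷ []) = refl
op-word up F.zero ((true , false) ∷ []) = refl
op-word up F.zero ((false , true) ∷ []) = refl
op-word up F.zero ((false , false) ∷ []) = refl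
op-word d F.zero (e₀ ∷ e₁ ∷ v) = begin
    op d F.zero (word (e₀ ∷ e₁ ∷ v))
  ≡⟨ cong (op d F.zero) (word-window e₀ e₁ v) ⟩
    op d F.zero (windowL e₀ e₁ ++ M ++ windowR e₀ e₁)
  ≡⟨ op-insert d F.zero (windowL e₀ e₁) M (windowR e₀ e₁) (shift²-unsigned (word v)) ⟩
    Maybe.map (insertAt (length (windowL e₀ e₁)) M) (op d F.zero (windowL e₀ e₁ ++ windowR e₀ e₁))
  ≡⟨ pairOp-window d e₀ e₁ M ⟩
    Maybe.map (λ p → windowL (proj₁ p) (proj₂ p) ++ M ++ windowR (proj₁ p) (proj₂ p)) (pairOp d e₀ e₁)
  ≡⟨ trans (map-cong (λ p → sym (word-window (proj₁ p) (proj₂ p) v)) (pairOp d e₀ e₁)) (map-∘ (pairOp d e₀ e₁)) ⟩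
    Maybe.map word (Maybe.map (prepend₂ v) (pairOp d e₀ e₁))
  ∎
  where
  open ≡-Reasoning
  M = map shift (map shift (word v))
op-word d (F.suc i) ((u , b) ∷ v) = begin
    op d (F.suc i) (U ++ map shift (word v) ++ B)
  ≡⟨ op-prefix d (F.suc i) U _ (optional-unsigned (F.suc i) u (unbar F.zero) refl) ⟩
    Maybe.map (U ++_) (op d (F.suc i) (map shift (word v) ++ B))
  ≡⟨ cong (Maybe.map (U ++_)) (op-suffix d (F.suc i) (map shift (word v)) B (optional-unsigned (F.suc i) b (bar F.zero) refl)) ⟩
    Maybe.map (U ++_) (Maybe.map (_++ B) (op d (F.suc i) (map shift (word v))))
  ≡⟨ cong (λ r → Maybe.map (U ++_) (Maybe.map (_++ B) r)) (trans (op-shift d i (word v)) (cong (Maybe.map (map shift)) (op-word d i v))) ⟩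
    Maybe.map (U ++_) (Maybe.map (_++ B) (Maybe.map (map shift) (Maybe.map word (colOp d i v))))
  ≡⟨ fuse (colOp d i v) ⟩
    Maybe.map word (Maybe.map ((u , b) ∷_) (colOp d i v))
  ∎
  where
  open ≡-Reasoning
  U = optional u (unbar F.zero)
  B = optional b (bar F.zero)
  fuse : ∀ r → Maybe.map (U ++_) (Maybe.map (_++ B) (Maybe.map (map shift) (Maybe.map word r)))
             ≡ Maybe.map word (Maybe.map ((u , b) ∷_) r)
  fuse nothing = refl
  fuse (just _) = refl

-- Admissibility and the insertion of z, z̄

-- c is the slack m − N(m) reached before v: an empty pair raises it, a full pair lowers it
admissible : ∀ {n} → ℕ → Col n → Bool
admissible c [] = true
admissible c ((false , false) ∷ v) = admissible (suc c) v
admissible c ((true , false) ∷ v) = admissible c v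
admissible c ((false , true) ∷ v) = admissible c v
admissible zero ((true , true) ∷ v) = false
admissible (suc c) ((true , true) ∷ v) = admissible c v

-- z is the first empty pair reached at slack 0 after which the column is still admissible;
-- the ℕ.pred is only reached with positive slack on admissible columns
insertZ : ∀ {n} → ℕ → Col n → Col n
insertZ c [] = []
insertZ c ((true , false) ∷ v) = (true , false) ∷ insertZ c v
insertZ c ((false , true) ∷ v) = (false , true) ∷ insertZ c v
insertZ c ((true , true) ∷ v) = (true , true) ∷ insertZ (ℕ.pred c) v
insertZ zero ((false , false) ∷ v) = if admissible 0 v then (true , true) ∷ v else (false , false) ∷ insertZ 1 v
insertZ (suc c) ((false , false) ∷ v) = (false , false) ∷ insertZ (suc (suc c)) v

pairOp-admissible : ∀ {n} d c e₀ e₁ (rest : Col n) →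
  MaybeAll.All (λ v′ → admissible c v′ ≡ admissible c (e₀ ∷ e₁ ∷ rest)) (colOp d F.zero (e₀ ∷ e₁ ∷ rest))
pairOp-admissible down c (true , true) (true , true) rest = MaybeAll.nothing
pairOp-admissible down c (true , true) (true , false) rest = MaybeAll.nothing
pairOp-admissible down zero (true , true) (false , true) rest = MaybeAll.just refl
pairOp-admissible down (suc c) (true , true) (false , true) rest = MaybeAll.just refl
pairOp-admissible down c (true , true) (false , false) rest = MaybeAll.nothing
pairOp-admissible down zero (true , false) (true , true) rest = MaybeAll.just refl
pairOp-admissible down (suc c) (true , false) (true , true) rest = MaybeAll.just refl
pairOp-admissible down c (true , false) (true , false) rest = MaybeAll.nothing
pairOp-admissible down c (true , false) (false , true) rest = MaybeAll.just refl
pairOp-admissible down c (true , false) (false , false) rest = MaybeAll.just refl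
pairOp-admissible down c (false , true) (true , true) rest = MaybeAll.nothing
pairOp-admissible down c (false , true) (true , false) rest = MaybeAll.nothing
pairOp-admissible down c (false , true) (false , true) rest = MaybeAll.nothing
pairOp-admissible down c (false , true) (false , false) rest = MaybeAll.nothing
pairOp-admissible down c (false , false) (true , true) rest = MaybeAll.just refl
pairOp-admissible down c (false , false) (true , false) rest = MaybeAll.nothing
pairOp-admissible down c (false , false) (false , true) rest = MaybeAll.just refl
pairOp-admissible down c (false , false) (false , false) rest = MaybeAll.nothing
pairOp-admissible up c (true , true) (true , true) rest = MaybeAll.nothing
pairOp-admissible up zero (true , true) (true , false) rest = MaybeAll.just refl
pairOp-admissible up (suc c) (true , true) (true , false) rest = MaybeAll.just refl
pairOp-admissible up c (true , true) (false , true) rest = MaybeAll.nothing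
pairOp-admissible up c (true , true) (false , false) rest = MaybeAll.nothing
pairOp-admissible up c (true , false) (true , true) rest = MaybeAll.nothing
pairOp-admissible up c (true , false) (true , false) rest = MaybeAll.nothing
pairOp-admissible up c (true , false) (false , true) rest = MaybeAll.nothing
pairOp-admissible up c (true , false) (false , false) rest = MaybeAll.nothing
pairOp-admissible up zero (false , true) (true , true) rest = MaybeAll.just refl
pairOp-admissible up (suc c) (false , true) (true , true) rest = MaybeAll.just refl
pairOp-admissible up c (false , true) (true , false) rest = MaybeAll.just refl
pairOp-admissible up c (false , true) (false , true) rest = MaybeAll.nothing
pairOp-admissible up c (false , true) (false , false) rest = MaybeAll.just refl
pairOp-admissible up c (false , false) (true , true) rest = MaybeAll.just refl
pairOp-admissible up c (false , false) (true , false) rest = MaybeAll.just refl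
pairOp-admissible up c (false , false) (false , true) rest = MaybeAll.nothing
pairOp-admissible up c (false , false) (false , false) rest = MaybeAll.nothing

admissible-colOp : ∀ {n} d c (i : Fin n) v → MaybeAll.All (λ v′ → admissible c v′ ≡ admissible c v) (colOp d i v)
admissible-colOp down c F.zero ((true , false) ∷ []) = MaybeAll.just refl
admissible-colOp up c F.zero ((false , true) ∷ []) = MaybeAll.just refl
admissible-colOp down c F.zero ((true , true) ∷ []) = MaybeAll.nothing
admissible-colOp down c F.zero ((false , true) ∷ []) = MaybeAll.nothing
admissible-colOp down c F.zero ((false , false) ∷ []) = MaybeAll.nothing
admissible-colOp up c F.zero ((true , true) ∷ []) = MaybeAll.nothing
admissible-colOp up c F.zero ((true , false) ∷ []) = MaybeAll.nothing
admissible-colOp up c F.zero ((false , false) ∷ []) = MaybeAll.nothing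
admissible-colOp d c F.zero (e₀ ∷ e₁ ∷ v) = pairOp-admissible d c e₀ e₁ v
admissible-colOp d c (F.suc i) ((false , false) ∷ v) = MaybeAllP.map⁺ (admissible-colOp d (suc c) i v)
admissible-colOp d c (F.suc i) ((true , false) ∷ v) = MaybeAllP.map⁺ (admissible-colOp d c i v)
admissible-colOp d c (F.suc i) ((false , true) ∷ v) = MaybeAllP.map⁺ (admissible-colOp d c i v)
admissible-colOp d zero (F.suc i) ((true , true) ∷ v) = MaybeAllP.map⁺ (MaybeAll.universal (λ _ → refl) (colOp d i v))
admissible-colOp d (suc c) (F.suc i) ((true , true) ∷ v) = MaybeAllP.map⁺ (admissible-colOp d c i v)

insertZ-here : ∀ {n} (v : Col n) → admissible 0 v ≡ true → insertZ 0 ((false , false) ∷ v) ≡ (true , true) ∷ v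
insertZ-here v a rewrite a = refl

insertZ-later : ∀ {n} (v : Col n) → admissible 0 v ≡ false → insertZ 0 ((false , false) ∷ v) ≡ (false , false) ∷ insertZ 1 v
insertZ-later v a rewrite a = refl

pairOp-insertZ : ∀ {n} d c e₀ e₁ (rest : Col n) → admissible c (e₀ ∷ e₁ ∷ rest) ≡ true →
  colOp d F.zero (insertZ c (e₀ ∷ e₁ ∷ rest)) ≡ Maybe.map (insertZ c) (colOp d F.zero (e₀ ∷ e₁ ∷ rest))
pairOp-insertZ down c (true , true) (true , true) rest _ = refl
pairOp-insertZ down c (true , true) (true , false) rest _ = refl
pairOp-insertZ down c (true , true) (false , true) rest _ = refl
pairOp-insertZ down zero (true , true) (false , false) rest ()
pairOp-insertZ down (suc zero) (true , true) (false , false) rest a with admissible 0 rest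
... | true = refl
... | false = refl
pairOp-insertZ down (suc (suc c)) (true , true) (false , false) rest _ = refl
pairOp-insertZ down c (true , false) (true , true) rest _ = refl
pairOp-insertZ down c (true , false) (true , false) rest _ = refl
pairOp-insertZ down zero (true , false) (false , true) rest _ = refl
pairOp-insertZ down (suc c) (true , false) (false , true) rest _ = refl
pairOp-insertZ down zero (true , false) (false , false) rest a with admissible 0 rest
... | true = refl
... | false = refl
pairOp-insertZ down (suc c) (true , false) (false , false) rest _ = refl
pairOp-insertZ down c (false , true) (true , true) rest _ = refl
pairOp-insertZ down c (false , true) (true , false) rest _ = refl
pairOp-insertZ down c (false , true) (false , true) rest _ = refl
pairOp-insertZ down zero (false , true) (false , false) rest a with admissible 0 rest
... | true = refl
... | false = refl
pairOp-insertZ down (suc c) (false , true) (false , false) rest _ = refl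
pairOp-insertZ down zero (false , false) (true , true) rest _ = refl
pairOp-insertZ down (suc c) (false , false) (true , true) rest _ = refl
pairOp-insertZ down zero (false , false) (true , false) rest a with admissible 0 rest
... | true = refl
... | false = refl
pairOp-insertZ down (suc c) (false , false) (true , false) rest _ = refl
pairOp-insertZ down zero (false , false) (false , true) rest a with admissible 0 rest
... | true = refl
... | false = refl
pairOp-insertZ down (suc c) (false , false) (false , true) rest _ = refl
pairOp-insertZ down zero (false , false) (false , false) rest a with admissible 1 rest
... | true = refl
... | false = refl
pairOp-insertZ down (suc c) (false , false) (false , false) rest _ = refl
pairOp-insertZ up c (true , true) (true , true) rest _ = refl
pairOp-insertZ up c (true , true) (true , false) rest _ = refl
pairOp-insertZ up c (true , true) (false , true) rest _ = refl
pairOp-insertZ up zero (true , true) (false , false) rest ()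
pairOp-insertZ up (suc zero) (true , true) (false , false) rest a with admissible 0 rest
... | true = refl
... | false = refl
pairOp-insertZ up (suc (suc c)) (true , true) (false , false) rest _ = refl
pairOp-insertZ up c (true , false) (true , true) rest _ = refl
pairOp-insertZ up c (true , false) (true , false) rest _ = refl
pairOp-insertZ up c (true , false) (false , true) rest _ = refl
pairOp-insertZ up zero (true , false) (false , false) rest a with admissible 0 rest
... | true = refl
... | false = refl
pairOp-insertZ up (suc c) (true , false) (false , false) rest _ = refl
pairOp-insertZ up c (false , true) (true , true) rest _ = refl
pairOp-insertZ up zero (false , true) (true , false) rest _ = refl
pairOp-insertZ up (suc c) (false , true) (true , false) rest _ = refl
pairOp-insertZ up c (false , true) (false , true) rest _ = refl
pairOp-insertZ up zero (false , true) (false , false) rest a with admissible 0 rest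
... | true = refl
... | false = refl
pairOp-insertZ up (suc c) (false , true) (false , false) rest _ = refl
pairOp-insertZ up zero (false , false) (true , true) rest _ = refl
pairOp-insertZ up (suc c) (false , false) (true , true) rest _ = refl
pairOp-insertZ up zero (false , false) (true , false) rest a with admissible 0 rest
... | true = refl
... | false = refl
pairOp-insertZ up (suc c) (false , false) (true , false) rest _ = refl
pairOp-insertZ up zero (false , false) (false , true) rest a with admissible 0 rest
... | true = refl
... | false = refl
pairOp-insertZ up (suc c) (false , false) (false , true) rest _ = refl
pairOp-insertZ up zero (false , false) (false , false) rest a with admissible 1 rest
... | true = refl
... | false = refl
pairOp-insertZ up (suc c) (false , false) (false , false) rest _ = refl

insertZ-colOp : ∀ {n} d c (i : Fin n) v → admissible c v ≡ true →
  colOp d i (insertZ c v) ≡ Maybe.map (insertZ c) (colOp d i v)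
insertZ-colOp down zero F.zero ((false , false) ∷ []) _ = refl
insertZ-colOp down (suc c) F.zero ((false , false) ∷ []) _ = refl
insertZ-colOp down c F.zero ((true , false) ∷ []) _ = refl
insertZ-colOp down c F.zero ((false , true) ∷ []) _ = refl
insertZ-colOp down c F.zero ((true , true) ∷ []) _ = refl
insertZ-colOp up zero F.zero ((false , false) ∷ []) _ = refl
insertZ-colOp up (suc c) F.zero ((false , false) ∷ []) _ = refl
insertZ-colOp up c F.zero ((true , false) ∷ []) _ = refl
insertZ-colOp up c F.zero ((false , true) ∷ []) _ = refl
insertZ-colOp up c F.zero ((true , true) ∷ []) _ = refl
insertZ-colOp d c F.zero (e₀ ∷ e₁ ∷ v) a = pairOp-insertZ d c e₀ e₁ v a
insertZ-colOp d c (F.suc i) ((true , false) ∷ v) a rewrite insertZ-colOp d c i v a = map-commute (λ _ → refl) (colOp d i v)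
insertZ-colOp d c (F.suc i) ((false , true) ∷ v) a rewrite insertZ-colOp d c i v a = map-commute (λ _ → refl) (colOp d i v)
insertZ-colOp d zero (F.suc i) ((true , true) ∷ v) ()
insertZ-colOp d (suc c) (F.suc i) ((true , true) ∷ v) a rewrite insertZ-colOp d c i v a = map-commute (λ _ → refl) (colOp d i v)
insertZ-colOp d (suc c) (F.suc i) ((false , false) ∷ v) a rewrite insertZ-colOp d (suc (suc c)) i v a =
  map-commute (λ _ → refl) (colOp d i v)
-- whether z is inserted here depends only on admissible 0 v, which colOp does not change
insertZ-colOp d zero (F.suc i) ((false , false) ∷ v) a with admissible 0 v in a₀
... | true = trans (sym (map-cong-local (MaybeAll.map (λ same → insertZ-here _ (trans same a₀)) (admissible-colOp d 0 i v))))
                   (map-∘ (colOp d i v))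
... | false rewrite insertZ-colOp d 1 i v a =
  trans (sym (map-∘ (colOp d i v)))
        (trans (sym (map-cong-local (MaybeAll.map (λ same → insertZ-later _ (trans same a₀)) (admissible-colOp d 0 i v))))
               (map-∘ (colOp d i v)))

-- Counting letters and locating z

filter-map : ∀ {A B : Set} {P : Pred B 0ℓ} {Q : Pred A 0ℓ} (P? : Decidable P) (Q? : Decidable Q) (f : A → B) →
  (∀ x → does (P? (f x)) ≡ does (Q? x)) → ∀ xs → filter P? (map f xs) ≡ map f (filter Q? xs)
filter-map P? Q? f same [] = refl
filter-map P? Q? f same (x ∷ xs) with does (P? (f x)) | does (Q? x) | same x
... | true | true | refl = cong (f x ∷_) (filter-map P? Q? f same xs)
... | false | false | refl = filter-map P? Q? f same xs

bit : Bool → ℕ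
bit true = 1
bit false = 0

size : Bool × Bool → ℕ
size (u , b) = bit u + bit b

-- count k v is N(k + 1) in word v: Fin indices are one below the letters
count : ∀ {n} → Fin n → Col n → ℕ
count F.zero (e ∷ v) = size e
count (F.suc k) (e ∷ v) = size e + count k v

Ncount-++ : ∀ {n} (k : Fin n) w w′ → Ncount k (w ++ w′) ≡ Ncount k w + Ncount k w′
Ncount-++ k w w′ = trans (cong length (filter-++ _ w w′)) (length-++ (filter _ w))

Ncount-optional : ∀ {n} (k : Fin (suc n)) u x → inN k x ≡ true → Ncount k (optional u x) ≡ bit u
Ncount-optional k true x inx rewrite inx = refl
Ncount-optional k false x inx = refl

inN-shift : ∀ {n} (k : Fin n) x → inN (F.suc k) (shift x) ≡ inN k x
inN-shift k (unbar j) = ⌊≤?⌋-suc j k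
  where
  ⌊≤?⌋-suc : ∀ {n} (j k : Fin n) → ⌊ F.suc j F.≤? F.suc k ⌋ ≡ ⌊ j F.≤? k ⌋
  ⌊≤?⌋-suc j k with F.suc j F.≤? F.suc k | j F.≤? k
  ... | yes _ | yes _ = refl
  ... | no _ | no _ = refl
  ... | yes p | no q = ⊥-elim (q (ℕ.s≤s⁻¹ p))
  ... | no p | yes q = ⊥-elim (p (s≤s q))
inN-shift k (bar j) = inN-shift k (unbar j)

Ncount-shift : ∀ {n} (k : Fin n) w → Ncount (F.suc k) (map shift w) ≡ Ncount k w
Ncount-shift k w =
  trans (cong length (filter-map (counted (F.suc k)) (counted k) shift (λ x → cong (λ b → does (b Data.Bool.≟ true)) (inN-shift k x)) w))
        (length-map shift (filter (counted k) w))
  where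
  counted : ∀ {n} (k : Fin n) → Decidable (λ x → inN k x ≡ true)
  counted k x = inN k x Data.Bool.≟ true

Ncount-shift-zero : ∀ {n} (w : Word n) → Ncount F.zero (map shift w) ≡ 0
Ncount-shift-zero w = cong length (filter-none _ (AllP.map⁺ (AllL.universal outside w)))
  where
  outside : ∀ x → inN F.zero (shift x) ≢ true
  outside (unbar _) ()
  outside (bar _) ()

Ncount-word : ∀ {n} (k : Fin n) v → Ncount k (word v) ≡ count k v
Ncount-word k ((u , b) ∷ v) = begin
    Ncount k (optional u (unbar F.zero) ++ map shift (word v) ++ optional b (bar F.zero))
  ≡⟨ trans (Ncount-++ k (optional u _) _) (cong (Ncount k (optional u _) +_) (Ncount-++ k (map shift (word v)) _)) ⟩
    Ncount k (optional u (unbar F.zero)) + (Ncount k (map shift (word v)) + Ncount k (optional b (bar F.zero)))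
  ≡⟨ cong₂ (λ x y → x + (Ncount k (map shift (word v)) + y)) (Ncount-optional k u _ refl) (Ncount-optional k b _ refl) ⟩
    bit u + (Ncount k (map shift (word v)) + bit b)
  ≡⟨ middle k ⟩
    count k ((u , b) ∷ v)
  ∎
  where
  open ≡-Reasoning
  middle : ∀ k → bit u + (Ncount k (map shift (word v)) + bit b) ≡ count k ((u , b) ∷ v)
  middle F.zero rewrite Ncount-shift-zero (word v) = refl
  middle (F.suc k) rewrite Ncount-shift k (word v) | Ncount-word k v =
    trans (cong (bit u +_) (+-comm (count k v) (bit b))) (sym (+-assoc (bit u) (bit b) (count k v)))

occurs : ∀ {n} → Letter n → Col n → Bool
occurs (unbar k) v = proj₁ (lookup v k)
occurs (bar k) v = proj₂ (lookup v k)

∈-optional : ∀ {A : Set} {x y : A} b → x ∈ optional b y → x ≡ y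
∈-optional true (here eq) = eq

∈-word⁺ : ∀ {n} x (v : Col n) → occurs x v ≡ true → x ∈ word v
∈-word⁺ (unbar F.zero) ((true , b) ∷ v) refl = here refl
∈-word⁺ (bar F.zero) ((u , true) ∷ v) refl = ∈-++⁺ʳ (optional u _) (∈-++⁺ʳ (map shift (word v)) (here refl))
∈-word⁺ (unbar (F.suc k)) ((u , b) ∷ v) occ = ∈-++⁺ʳ (optional u _) (∈-++⁺ˡ (∈-map⁺ shift (∈-word⁺ (unbar k) v occ)))
∈-word⁺ (bar (F.suc k)) ((u , b) ∷ v) occ = ∈-++⁺ʳ (optional u _) (∈-++⁺ˡ (∈-map⁺ shift (∈-word⁺ (bar k) v occ)))

∈-word⁻ : ∀ {n} x (v : Col n) → x ∈ word v → occurs x v ≡ true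
∈-word⁻ x ((u , b) ∷ v) x∈ with ∈-++⁻ (optional u (unbar F.zero)) x∈
... | inj₁ x∈u with ∈-optional u x∈u
...   | refl = first u x∈u
  where
  first : ∀ u → unbar F.zero ∈ optional u (unbar F.zero) → u ≡ true
  first true _ = refl
∈-word⁻ x ((u , b) ∷ v) x∈ | inj₂ x∈rest with ∈-++⁻ (map shift (word v)) x∈rest
... | inj₂ x∈b with ∈-optional b x∈b
...   | refl = last b x∈b
  where
  last : ∀ b → bar F.zero ∈ optional b (bar F.zero) → b ≡ true
  last true _ = refl
∈-word⁻ x ((u , b) ∷ v) x∈ | inj₂ x∈rest | inj₁ x∈shifted with ∈-map⁻ shift x∈shifted
... | unbar k , x′∈ , refl = ∈-word⁻ (unbar k) v x′∈
... | bar k , x′∈ , refl = ∈-word⁻ (bar k) v x′∈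

true⇔true⇒≡ : ∀ {a b : Bool} → (a ≡ true → b ≡ true) → (b ≡ true → a ≡ true) → a ≡ b
true⇔true⇒≡ {true} a⇒b _ = sym (a⇒b refl)
true⇔true⇒≡ {false} {true} _ b⇒a = b⇒a refl
true⇔true⇒≡ {false} {false} _ _ = refl

word-injective : ∀ {n} (v v′ : Col n) → word v ≡ word v′ → v ≡ v′
word-injective v v′ eq = begin
    v
  ≡⟨ sym (tabulate∘lookup v) ⟩
    tabulate (lookup v)
  ≡⟨ tabulate-cong (λ k → cong₂ _,_ (same (unbar k)) (same (bar k))) ⟩
    tabulate (lookup v′)
  ≡⟨ tabulate∘lookup v′ ⟩
    v′
  ∎
  where
  open ≡-Reasoning
  same : ∀ x → occurs x v ≡ occurs x v′
  same x = true⇔true⇒≡ (λ o → ∈-word⁻ x v′ (subst (x ∈_) eq (∈-word⁺ x v o)))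
                  (λ o → ∈-word⁻ x v (subst (x ∈_) (sym eq) (∈-word⁺ x v′ o)))

filter-tabulate-suc : ∀ {n} {P : Pred (Fin (suc n)) 0ℓ} {Q : Pred (Fin n) 0ℓ} (P? : Decidable P) (Q? : Decidable Q) →
  (∀ k → does (P? (F.suc k)) ≡ does (Q? k)) → filter P? (List.tabulate F.suc) ≡ map F.suc (filter Q? (allFin n))
filter-tabulate-suc P? Q? same = trans (cong (filter P?) (sym (map-tabulate id F.suc))) (filter-map P? Q? F.suc same (allFin _))

head-filter-allFin : ∀ {n} {P : Pred (Fin n) 0ℓ} (P? : Decidable P) z → P z → (∀ k → toℕ k < toℕ z → ¬ P k) →
  head (filter P? (allFin n)) ≡ just z
head-filter-allFin {suc n} P? F.zero pz _ with P? F.zero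
... | yes _ = refl
... | no ¬p0 = ⊥-elim (¬p0 pz)
head-filter-allFin {suc n} P? (F.suc z) pz minimal with P? F.zero
... | yes p0 = ⊥-elim (minimal F.zero (s≤s z≤n) p0)
... | no _ = begin
    head (filter P? (List.tabulate F.suc))
  ≡⟨ cong head (filter-tabulate-suc P? (λ k → P? (F.suc k)) (λ _ → refl)) ⟩
    head (map F.suc (filter (λ k → P? (F.suc k)) (allFin n)))
  ≡⟨ head-map (filter (λ k → P? (F.suc k)) (allFin n)) ⟩
    Maybe.map F.suc (head (filter (λ k → P? (F.suc k)) (allFin n)))
  ≡⟨ cong (Maybe.map F.suc) (head-filter-allFin (λ k → P? (F.suc k)) z pz (λ k k<z → minimal (F.suc k) (s≤s k<z))) ⟩
    just (F.suc z)
  ∎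
  where open ≡-Reasoning

index : ∀ {n} → Letter n → Fin n
index (unbar k) = k
index (bar k) = k

keeps : ∀ {n} → Fin n → Letter n → Bool
keeps z x = not (does (index x F.≟ z))

keeps-zero-shift : ∀ {n} (x : Letter n) → keeps F.zero (shift x) ≡ true
keeps-zero-shift (unbar _) = refl
keeps-zero-shift (bar _) = refl

keeps-shift : ∀ {n} (z : Fin n) x → keeps (F.suc z) (shift x) ≡ keeps z x
keeps-shift z (unbar _) = refl
keeps-shift z (bar _) = refl

xi-keeps : ∀ {n} (z : Fin n) x → does (¬? ((x ≟L unbar z) ⊎-dec (x ≟L bar z))) ≡ keeps z x
xi-keeps z (unbar j) with j F.≟ z
... | yes refl = refl
... | no _ = refl
xi-keeps z (bar j) with j F.≟ z
... | yes refl = refl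
... | no _ = refl

filter-optional-accepted : ∀ {A : Set} {P : Pred A 0ℓ} (P? : Decidable P) b {x} → does (P? x) ≡ true →
  filter P? (optional b x) ≡ optional b x
filter-optional-accepted P? true {x} acc with does (P? x)
... | true = refl
filter-optional-accepted P? false acc = refl

filter-optional-rejected : ∀ {A : Set} {P : Pred A 0ℓ} (P? : Decidable P) b {x} → does (P? x) ≡ false →
  filter P? (optional b x) ≡ []
filter-optional-rejected P? true {x} rej with does (P? x)
... | false = refl
filter-optional-rejected P? false rej = refl

filter-accepted : ∀ {A : Set} {P : Pred A 0ℓ} (P? : Decidable P) → (∀ x → does (P? x) ≡ true) → ∀ xs → filter P? xs ≡ xs
filter-accepted P? acc [] = refl
filter-accepted P? acc (x ∷ xs) with does (P? x) | acc x
... | true | refl = cong (x ∷_) (filter-accepted P? acc xs)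

filter-word : ∀ {n} {P : Pred (Letter (suc n)) 0ℓ} (P? : Decidable P) u b (v : Col n) →
  filter P? (word ((u , b) ∷ v))
  ≡ filter P? (optional u (unbar F.zero)) ++ map shift (filter (λ x → P? (shift x)) (word v)) ++ filter P? (optional b (bar F.zero))
filter-word P? u b v
  rewrite filter-++ P? (optional u (unbar F.zero)) (map shift (word v) ++ optional b (bar F.zero))
        | filter-++ P? (map shift (word v)) (optional b (bar F.zero))
        | filter-map P? (λ x → P? (shift x)) shift (λ _ → refl) (word v) = refl

filter-word-clear : ∀ {n} {P : Pred (Letter n) 0ℓ} (P? : Decidable P) z (v : Col n) → (∀ x → does (P? x) ≡ keeps z x) →
  filter P? (word v) ≡ word (v [ z ]≔ (false , false))
filter-word-clear P? F.zero ((u , b) ∷ v) spec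
  rewrite filter-word P? u b v
        | filter-optional-rejected P? u (spec (unbar F.zero))
        | filter-optional-rejected P? b (spec (bar F.zero))
        | filter-accepted (λ x → P? (shift x)) (λ x → trans (spec (shift x)) (keeps-zero-shift x)) (word v) = refl
filter-word-clear P? (F.suc z) ((u , b) ∷ v) spec
  rewrite filter-word P? u b v
        | filter-optional-accepted P? u (spec (unbar F.zero))
        | filter-optional-accepted P? b (spec (bar F.zero))
        | filter-word-clear (λ x → P? (shift x)) z v (λ x → trans (spec (shift x)) (keeps-shift z x)) = refl

xi-just : ∀ {n} (w : Word n) {z} → findZ w ≡ just z → xi w ≡ filter (λ x → ¬? ((x ≟L unbar z) ⊎-dec (x ≟L bar z))) w
xi-just w eq rewrite eq = refl

xi-nothing : ∀ {n} (w : Word n) → findZ w ≡ nothing → xi w ≡ w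
xi-nothing w eq rewrite eq = refl

findZ-nothing : ∀ {n} (w : Word n) → (∀ k → ¬ zCond w k) → findZ w ≡ nothing
findZ-nothing {n} w ¬z = cong head (filter-none (zCond? w) (AllL.universal ¬z (allFin n)))

¬zCond : ∀ {n} (G : Col n) k → count k G ≤ suc (toℕ k) → ¬ zCond (word G) k
¬zCond G k bound zc = 1+n≰n (subst (_≤ suc (toℕ k)) (trans (sym (Ncount-word k G)) (proj₂ zc)) bound)

data Inserted {n} (c : ℕ) (y : Col n) : Col n → Set where
  none : (∀ k → count k y ≤ c + suc (toℕ k)) → Inserted c y y
  at : ∀ {G} z → lookup G z ≡ (true , true) → count z G ≡ c + suc (suc (toℕ z)) →
       (∀ k → toℕ k < toℕ z → count k G ≤ c + suc (toℕ k)) → G [ z ]≔ (false , false) ≡ y → Inserted c y G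

+-slack-≡ : ∀ {a c c′} t → a + c′ ≡ suc c → a + (c′ + t) ≡ c + suc t
+-slack-≡ {a} {c} {c′} t slack = trans (sym (+-assoc a c′ t)) (trans (cong (_+ t) slack) (sym (+-suc c t)))

+-slack-≤ : ∀ {a c c′ x t} → a + c′ ≡ suc c → x ≤ c′ + t → a + x ≤ c + suc t
+-slack-≤ {a} {c} {c′} {t = t} slack x≤ = ≤-trans (+-monoʳ-≤ a x≤) (≤-reflexive (+-slack-≡ {a} {c} {c′} t slack))

Inserted-∷ : ∀ {n c c′ e} {v G : Col n} → size e + c′ ≡ suc c → size e ≤ c + 1 →
  Inserted c′ v G → Inserted c (e ∷ v) (e ∷ G)
Inserted-∷ {c = c} {c′} {e} slack first (none bound) = none bound′
  where
  bound′ : ∀ k → count k (e ∷ _) ≤ c + suc (toℕ k)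
  bound′ F.zero = first
  bound′ (F.suc k) = +-slack-≤ slack (bound k)
Inserted-∷ {c = c} {c′} {e} slack first (at z full N≡ below cleared) =
  at (F.suc z) full (trans (cong (size e +_) N≡) (+-slack-≡ {size e} {c} {c′} _ slack)) below′ (cong (e ∷_) cleared)
  where
  below′ : ∀ k → toℕ k < toℕ (F.suc z) → count k (e ∷ _) ≤ c + suc (toℕ k)
  below′ F.zero _ = first
  below′ (F.suc k) (s≤s k<z) = +-slack-≤ slack (below k k<z)

insertZ-inserted : ∀ {n} c (y : Col n) → admissible c y ≡ true → Inserted c y (insertZ c y)
insertZ-inserted c [] _ = none (λ ())
insertZ-inserted c ((true , false) ∷ y) a = Inserted-∷ refl (m≤n+m 1 c) (insertZ-inserted c y a)
insertZ-inserted c ((false , true) ∷ y) a = Inserted-∷ refl (m≤n+m 1 c) (insertZ-inserted c y a)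
insertZ-inserted (suc c) ((true , true) ∷ y) a = Inserted-∷ refl (s≤s (m≤n+m 1 c)) (insertZ-inserted c y a)
insertZ-inserted (suc c) ((false , false) ∷ y) a = Inserted-∷ refl z≤n (insertZ-inserted (suc (suc c)) y a)
insertZ-inserted zero ((false , false) ∷ y) a with admissible 0 y
... | true = at F.zero refl refl (λ _ ()) refl
... | false = Inserted-∷ refl z≤n (insertZ-inserted 1 y a)

xi-insertZ : ∀ {n} (y : Col n) → admissible 0 y ≡ true → xi (word (insertZ 0 y)) ≡ word y
xi-insertZ y a with insertZ 0 y | insertZ-inserted 0 y a
... | _ | none bound = xi-nothing (word y) (findZ-nothing (word y) (λ k → ¬zCond y k (bound k)))
... | G | at z full N≡ below cleared = begin
    xi (word G)
  ≡⟨ xi-just (word G) (head-filter-allFin (zCond? (word G)) z zc (λ k k<z → ¬zCond G k (below k k<z))) ⟩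
    filter (λ x → ¬? ((x ≟L unbar z) ⊎-dec (x ≟L bar z))) (word G)
  ≡⟨ filter-word-clear _ z G (xi-keeps z) ⟩
    word (G [ z ]≔ (false , false))
  ≡⟨ cong word cleared ⟩
    word y
  ∎
  where
  open ≡-Reasoning
  zc : zCond (word G) z
  zc = (∈-word⁺ (unbar z) G (cong proj₁ full) , ∈-word⁺ (bar z) G (cong proj₂ full)) , trans (Ncount-word z G) N≡

-- The starting vertices

map-suc : ∀ {n} (c : Fin n → Letter n) (c′ : Fin (suc n) → Letter (suc n)) → (∀ k → c′ (F.suc k) ≡ shift (c k)) →
  ∀ ks → map c′ (map F.suc ks) ≡ map shift (map c ks)
map-suc c c′ same ks = trans (sym (List.map-∘ ks)) (trans (List.map-cong same ks) (List.map-∘ ks))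

colUpTo-zero : ∀ n → colUpTo n 0 ≡ []
colUpTo-zero n = cong (map unbar) (filter-none _ (AllL.universal (λ _ ()) (allFin n)))

colUpTo-suc : ∀ n q → colUpTo (suc n) (suc q) ≡ unbar F.zero ∷ map shift (colUpTo n q)
colUpTo-suc n q = cong (unbar F.zero ∷_)
  (trans (cong (map unbar) (filter-tabulate-suc _ (λ k → suc (toℕ k) ℕ.≤? q) (λ _ → refl))) (map-suc unbar unbar (λ _ → refl) _))

barWord-one : ∀ n → barWord (suc n) 1 ≡ bar F.zero ∷ []
barWord-one n = cong (λ ks → bar F.zero ∷ map bar ks) (filter-none (λ k → suc (toℕ k) ℕ.≟ 1) (AllP.tabulate⁺ {f = F.suc} (λ _ ())))

barWord-suc : ∀ n q → barWord (suc n) (suc (suc q)) ≡ map shift (barWord n (suc q))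
barWord-suc n q =
  trans (cong (map bar) (filter-tabulate-suc _ (λ k → suc (toℕ k) ℕ.≟ suc q) (λ _ → refl))) (map-suc bar bar (λ _ → refl) _)

initial : (n q : ℕ) → Col n
initial zero q = []
initial (suc n) zero = (false , false) ∷ initial n zero
initial (suc n) (suc q) = (true , false) ∷ initial n q

admissible-initial : ∀ c n q → admissible c (initial n q) ≡ true
admissible-initial c zero q = refl
admissible-initial c (suc n) zero = admissible-initial (suc c) n zero
admissible-initial c (suc n) (suc q) = admissible-initial c n q

word-initial-zero : ∀ n → word (initial n 0) ≡ []
word-initial-zero zero = refl
word-initial-zero (suc n) rewrite word-initial-zero n = refl

colUpTo-initial : ∀ n q → colUpTo n q ≡ word (initial n q)
colUpTo-initial zero q = refl
colUpTo-initial (suc n) zero = trans (colUpTo-zero (suc n)) (sym (word-initial-zero (suc n)))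
colUpTo-initial (suc n) (suc q) rewrite colUpTo-suc n q | colUpTo-initial n q =
  cong (unbar F.zero ∷_) (sym (++-identityʳ _))

start-initial : ∀ n q → q < n → colUpTo n (suc q) ++ barWord n (suc q) ≡ word (insertZ 0 (initial n q))
start-initial (suc n) zero _ rewrite admissible-initial 0 n zero =
  trans (cong₂ _++_ (colUpTo-suc n zero) (barWord-one n))
        (cong (λ w → unbar F.zero ∷ map shift w ++ bar F.zero ∷ []) (colUpTo-initial n zero))
start-initial (suc n) (suc q) (s≤s q<n) = begin
    colUpTo (suc n) (suc (suc q)) ++ barWord (suc n) (suc (suc q))
  ≡⟨ cong₂ _++_ (colUpTo-suc n (suc q)) (barWord-suc n q) ⟩
    unbar F.zero ∷ map shift (colUpTo n (suc q)) ++ map shift (barWord n (suc q))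
  ≡⟨ cong (unbar F.zero ∷_) (sym (List.map-++ shift (colUpTo n (suc q)) (barWord n (suc q)))) ⟩
    unbar F.zero ∷ map shift (colUpTo n (suc q) ++ barWord n (suc q))
  ≡⟨ cong (λ w → unbar F.zero ∷ map shift w) (start-initial n q q<n) ⟩
    unbar F.zero ∷ map shift (word (insertZ 0 (initial n q)))
  ≡⟨ cong (unbar F.zero ∷_) (sym (++-identityʳ _)) ⟩
    word (insertZ 0 (initial (suc n) (suc q)))
  ∎
  where open ≡-Reasoning

-- The isomorphism

data Component {n} (y₀ : Col n) : Col n → Set where
  here : Component y₀ y₀
  step : ∀ {y y′} d i → Component y₀ y → colOp d i y ≡ just y′ → Component y₀ y′

Component-admissible : ∀ {n} {y₀ y : Col n} → admissible 0 y₀ ≡ true → Component y₀ y → admissible 0 y ≡ true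
Component-admissible a here = a
Component-admissible a (step {y} d i c eq) =
  trans (MaybeAll.drop-just (subst (MaybeAll.All _) eq (admissible-colOp d 0 i y))) (Component-admissible a c)

Intertwines : ∀ {n} → (Col n → Word n) → Set
Intertwines φ = ∀ d i y → admissible 0 y ≡ true → op d i (φ y) ≡ Maybe.map φ (colOp d i y)

word-intertwines : ∀ {n} → Intertwines {n} word
word-intertwines d i y _ = op-word d i y

insertZ-intertwines : ∀ {n} → Intertwines {n} (λ y → word (insertZ 0 y))
insertZ-intertwines d i y a =
  trans (op-word d i (insertZ 0 y)) (trans (cong (Maybe.map word) (insertZ-colOp d 0 i y a)) (sym (map-∘ (colOp d i y))))

Reach-op : ∀ {n} {u v v′ : Word n} d i → Reach u v → op d i v ≡ just v′ → Reach u v′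
Reach-op {v = v} down i r eq = viaF i r (trans (fOp≡op i v) eq)
Reach-op {v = v} up i r eq = viaE i r (trans (eOp≡op i v) eq)

Component⇒Reach : ∀ {n} {φ : Col n → Word n} {y₀ y} → Intertwines φ → admissible 0 y₀ ≡ true →
  Component y₀ y → Reach (φ y₀) (φ y)
Component⇒Reach φ-op a here = here
Component⇒Reach {φ = φ} φ-op a (step {y} d i c eq) =
  Reach-op d i (Component⇒Reach φ-op a c) (trans (φ-op d i y (Component-admissible a c)) (cong (Maybe.map φ) eq))

Component-step : ∀ {n} {φ : Col n → Word n} {y₀ y w′} d i → Intertwines φ → admissible 0 y₀ ≡ true →
  Component y₀ y → op d i (φ y) ≡ just w′ → ∃ λ y′ → Component y₀ y′ × w′ ≡ φ y′
Component-step {φ = φ} {y = y} d i φ-op a c eq with colOp d i y in e | trans (sym eq) (φ-op d i y (Component-admissible a c))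
... | just y′ | eq′ = y′ , step d i c e , just-injective eq′

Reach⇒Component : ∀ {n} {φ : Col n → Word n} {y₀ w} → Intertwines φ → admissible 0 y₀ ≡ true →
  Reach (φ y₀) w → ∃ λ y → Component y₀ y × w ≡ φ y
Reach⇒Component {y₀ = y₀} φ-op a here = y₀ , here , refl
Reach⇒Component {φ = φ} φ-op a (viaF i r eq) with Reach⇒Component φ-op a r
... | y , c , refl = Component-step down i φ-op a c (trans (sym (fOp≡op i (φ y))) eq)
Reach⇒Component {φ = φ} φ-op a (viaE i r eq) with Reach⇒Component φ-op a r
... | y , c , refl = Component-step up i φ-op a c (trans (sym (eOp≡op i (φ y))) eq)

xi-op : ∀ {n} (y₀ : Col n) {w} → admissible 0 y₀ ≡ true → Reach (word (insertZ 0 y₀)) w →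
  ∀ d i → Maybe.map xi (op d i w) ≡ op d i (xi w)
xi-op y₀ a r d i with Reach⇒Component {y₀ = y₀} insertZ-intertwines a r
... | y , c , refl = begin
    Maybe.map xi (op d i (word (insertZ 0 y)))
  ≡⟨ cong (Maybe.map xi) (insertZ-intertwines d i y a′) ⟩
    Maybe.map xi (Maybe.map (λ y′ → word (insertZ 0 y′)) (colOp d i y))
  ≡⟨ sym (map-∘ (colOp d i y)) ⟩
    Maybe.map (λ y′ → xi (word (insertZ 0 y′))) (colOp d i y)
  ≡⟨ map-cong-local (MaybeAll.map (λ {y′} same → xi-insertZ y′ (trans same a′)) (admissible-colOp d 0 i y)) ⟩
    Maybe.map word (colOp d i y)
  ≡⟨ sym (op-word d i y) ⟩
    op d i (word y)
  ≡⟨ cong (op d i) (sym (xi-insertZ y a′)) ⟩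
    op d i (xi (word (insertZ 0 y)))
  ∎
  where
  open ≡-Reasoning
  a′ = Component-admissible a c

xi-crystalIso : ∀ {n} (y₀ : Col n) → admissible 0 y₀ ≡ true → IsCrystalIso (word (insertZ 0 y₀)) (word y₀) xi
IsCrystalIso.into (xi-crystalIso y₀ a) w r with Reach⇒Component {y₀ = y₀} insertZ-intertwines a r
... | y , c , refl = subst (Reach (word y₀)) (sym (xi-insertZ y (Component-admissible a c))) (Component⇒Reach {y₀ = y₀} word-intertwines a c)
IsCrystalIso.injective (xi-crystalIso y₀ a) w w′ r r′ eq
  with Reach⇒Component {y₀ = y₀} insertZ-intertwines a r | Reach⇒Component {y₀ = y₀} insertZ-intertwines a r′
... | y , c , refl | y′ , c′ , refl = cong (λ v → word (insertZ 0 v))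
  (word-injective y y′ (trans (sym (xi-insertZ y (Component-admissible a c))) (trans eq (xi-insertZ y′ (Component-admissible a c′)))))
IsCrystalIso.surjective (xi-crystalIso y₀ a) w r with Reach⇒Component {y₀ = y₀} word-intertwines a r
... | y , c , refl = word (insertZ 0 y) , Component⇒Reach {y₀ = y₀} insertZ-intertwines a c , xi-insertZ y (Component-admissible a c)
IsCrystalIso.commute-f (xi-crystalIso y₀ a) w r i =
  trans (cong (Maybe.map xi) (fOp≡op i w)) (trans (xi-op y₀ a r down i) (sym (fOp≡op i (xi w))))
IsCrystalIso.commute-e (xi-crystalIso y₀ a) w r i =
  trans (cong (Maybe.map xi) (eOp≡op i w)) (trans (xi-op y₀ a r up i) (sym (eOp≡op i (xi w))))

lemma3p5 : (n p : ℕ) → 1 < p → p ≤ n →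
    IsCrystalIso (colUpTo n p ++ barWord n p) (colUpTo n (p ∸ 1)) xi
lemma3p5 n (suc (suc q)) (s≤s (s≤s z≤n)) p≤n =
  subst₂ (λ u v → IsCrystalIso u v xi) (sym (start-initial n (suc q) p≤n)) (sym (colUpTo-initial n (suc q)))
    (xi-crystalIso (initial n (suc q)) (admissible-initial 0 n (suc q)))
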